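{- Let $s \ge 2$ and let $\sigma$ be a string of length $n$ over $\Sigma = T \cup \bar{T}$ with $|T| = s$. Let $d$ be the minimum number of deletions needed to transform $\sigma$ into a string of $\mathrm{Dyck}(s)$. Then Random-deletion runs in linear time and, with constant probability, obtains a $2d$-approximation for edit distance with deletions only from $\sigma$ to $\mathrm{Dyck}(s)$ (i.e. the number of deletions it performs is within a factor $2d$ of the optimum number of deletions).
   Context: $T$ is a finite set of open parentheses; each $x \in T$ has a unique congruent close parenthesis $\bar{x}$, $\bar{T} = \{\bar{x} : x\in T\}$. $\mathrm{Dyck}(s)$ is the language of well-balanced strings over $T\cup\bar{T}$ generated by $S \to SS \mid \varepsilon \mid a S \bar{a}$ ($a \in T$). Random-deletion: initialize an empty stack and scan $\sigma$ left to right. If the current symbol is an open parenthesis, push it. If it is a close parenthesis: if the stack is empty, delete it; if the stack top is its matching open parenthesis, match (pop) them; otherwise delete either the stack top or the current symbol, each with probability $1/2$ independently. At the end of the scan, delete all symbols remaining in the stack. -}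

module Defs where

open import Data.Nat using (ℕ; zero; suc; _+_; _*_; _≤_; _≤?_)
open import Data.Fin using (Fin; _≟_)
open import Data.List using (List; []; _∷_; length; filter; map; _++_)
open import Data.Bool using (Bool; true; false)
open import Data.Product using (_×_; _,_; ∃)
open import Data.List.Relation.Binary.Sublist.Propositional using (_⊆_)
open import Relation.Nullary using (yes; no)
open import Relation.Binary.PropositionalEquality using (_≡_)

data Sym (s : ℕ) : Set where
  op : Fin s → Sym s
  cl : Fin s → Sym s

data Dyck {s : ℕ} : List (Sym s) → Set where
  ε    : Dyck []
  cat  : ∀ {u v} → Dyck u → Dyck v → Dyck (u ++ v)
  wrap : ∀ (a : Fin s) {u} → Dyck u → Dyck (op a ∷ u ++ cl a ∷ [])

MinDel : ∀ {s} → List (Sym s) → ℕ → Set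
MinDel {s} σ d =
  (∃ λ (τ : List (Sym s)) → τ ⊆ σ × Dyck τ × length τ + d ≡ length σ)
  × (∀ (τ : List (Sym s)) → τ ⊆ σ → Dyck τ → length τ + d ≤ length σ)

-- Result of a run: (number of deletions , number of elementary steps)
Res : Set
Res = ℕ × ℕ

tick : Res → Res
tick (x , t) = (x , suc t)

del : Res → Res
del (x , t) = (suc x , t)

-- Random-deletion, with the sequence of fair coin flips given explicitly
-- (consumed in order; true = delete the stack top, false = delete the
-- current symbol).  The stack holds the open parentheses (by type).
-- Every coin flip causes a deletion, so at most |σ| flips are used; if the
-- coin list ever runs out we (arbitrarily) delete the current symbol.
mutual
  rdel : ∀ {s} → List (Sym s) → List (Fin s) → List Bool → Res
  rdel [] st cs = (length st , length st)
  rdel (op a ∷ σ) st cs = tick (rdel σ (a ∷ st) cs)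
  rdel (cl a ∷ σ) st cs = closeStep a σ st cs

  closeStep : ∀ {s} → Fin s → List (Sym s) → List (Fin s) → List Bool → Res
  closeStep a σ [] cs = tick (del (rdel σ [] cs))
  closeStep a σ (x ∷ st) cs with x ≟ a
  ... | yes _ = tick (rdel σ st cs)
  closeStep a σ (x ∷ st) (true ∷ cs)  | no _ =
    tick (del (closeStep a σ st cs))
  closeStep a σ (x ∷ st) (false ∷ cs) | no _ =
    tick (del (rdel σ (x ∷ st) cs))
  closeStep a σ (x ∷ st) []           | no _ =
    tick (del (rdel σ (x ∷ st) []))

randomDeletion : ∀ {s} → List (Sym s) → List Bool → Res
randomDeletion σ cs = rdel σ [] cs

deletions : ∀ {s} → List (Sym s) → List Bool → ℕ
deletions σ cs with randomDeletion σ cs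
... | (x , _) = x

steps : ∀ {s} → List (Sym s) → List Bool → ℕ
steps σ cs with randomDeletion σ cs
... | (_ , t) = t

-- all 2^n coin sequences of length n (uniform probability space)
allCoins : ℕ → List (List Bool)
allCoins zero = [] ∷ []
allCoins (suc n) = map (true ∷_) (allCoins n) ++ map (false ∷_) (allCoins n)

goodCount : ∀ {s} → List (Sym s) → ℕ → ℕ
goodCount σ bound =
  length (filter (λ cs → deletions σ cs ≤? bound) (allCoins (length σ)))

-- Random-deletion maintains an invariant: the current stack and the unread
-- input can still be completed to a Dyck subsequence of σ with k further
-- deletions, where initially k = d.  Pushes, matches and forced deletions keep
-- it; at a mismatch one of the two possible deletions is compatible with such
-- a completion and leaves k − 1, while the other leaves k + 1.  Coupling the
-- good coin value with a down-step, the run deletes at most k + 2u symbols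
-- whenever the ±1 random walk from d reaches 0 before its (u + 1)-st up-step.
-- With u = d(d − 1) this happens whenever the first N = d + 2u ≤ 2d² coins show
-- at least d more heads than tails, and a fourth-moment (Paley–Zygmund)
-- estimate bounds the probability of that below by 1/54.  Each input symbol
-- costs at most two steps, so the run takes linear time.

module Submission where

open import Defs
open import Data.Nat
open import Data.Nat.Properties
open import Data.Fin using (Fin) renaming (_≟_ to _≟ᶠ_)
open import Data.Bool using (Bool; true; false)
open import Data.List using (List; []; _∷_; length; _++_; map; filter; take; drop)
open import Data.List.Properties
  using (++-assoc; ++-identityʳ; filter-++; length-++; length-take; take++drop≡id)
open import Data.List.Relation.Binary.Sublist.Propositional
  using (_⊆_; []; _∷_; _∷ʳ_; ⊆-refl; ⊆-trans)
open import Data.List.Relation.Binary.Sublist.Propositional.Properties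
  using (length-mono-≤; ∷ˡ⁻)
open import Data.Product using (∃; _×_; _,_; proj₁; proj₂)
open import Data.Sum using (_⊎_; inj₁; inj₂)
open import Data.Empty using (⊥-elim)
open import Relation.Nullary using (¬_; Dec; yes; no)
open import Relation.Unary using (Pred; Decidable)
open import Function using (_∘_)
open import Relation.Binary.PropositionalEquality
open import Data.Nat.Tactic.RingSolver using (solve-∀)
open import Algebra.Properties.CommutativeSemigroup +-commutativeSemigroup
  using () renaming (interchange to +-interchange)

private
  variable
    s : ℕ
    a : Fin s
    st : List (Fin s)
    σ τ : List (Sym s)

-- Balanced words and the completion invariant

-- Balanced st w: w is well nested, except that it additionally closes the
-- parentheses of the stack st, top first.
data Balanced {s : ℕ} : List (Fin s) → List (Sym s) → Set where
  []   : Balanced [] []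
  push : ∀ {st w} a → Balanced (a ∷ st) w → Balanced st (op a ∷ w)
  pop  : ∀ {st w} a → Balanced st w → Balanced (a ∷ st) (cl a ∷ w)

dyck-++-balanced : Dyck σ → Balanced st τ → Balanced st (σ ++ τ)
dyck-++-balanced ε b = b
dyck-++-balanced {τ = τ} (cat {u} {v} d e) b
  rewrite ++-assoc u v τ = dyck-++-balanced d (dyck-++-balanced e b)
dyck-++-balanced {τ = τ} (wrap a {u} d) b
  rewrite ++-assoc u (cl a ∷ []) τ = push a (dyck-++-balanced d (pop a b))

balanced-drop : Balanced (a ∷ st) σ →
  ∃ λ τ → τ ⊆ σ × length σ ≡ suc (length τ) × Balanced st τ
balanced-drop b = go [] b refl
  where
  go : ∀ ys {st′ σ} → Balanced st′ σ → st′ ≡ ys ++ a ∷ st →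
       ∃ λ τ → τ ⊆ σ × length σ ≡ suc (length τ) × Balanced (ys ++ st) τ
  go []       []         ()
  go (_ ∷ _)  []         ()
  go ys       (push b w) refl with go (b ∷ ys) w refl
  ... | τ , τ⊆ , len , w′ = op b ∷ τ , refl ∷ τ⊆ , cong suc len , push b w′
  go []       (pop _ w)  refl = _ , _ ∷ʳ ⊆-refl , refl , w
  go (y ∷ ys) (pop .y w) refl with go ys w refl
  ... | τ , τ⊆ , len , w′ = cl y ∷ τ , refl ∷ τ⊆ , cong suc len , pop y w′

size : List (Fin s) → List (Sym s) → ℕ
size st σ = length st + length σ

-- In the scan state with stack st and unread input σ, at most k further
-- deletions suffice to reach a Dyck string.
data Completable {s} (k : ℕ) (st : List (Fin s)) (σ : List (Sym s)) : Set where
  completion : ∀ {st′ τ} → st′ ⊆ st → τ ⊆ σ → Balanced st′ τ →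
               size st σ ≤ size st′ τ + k → Completable k st σ

size-mono : ∀ {st′ st : List (Fin s)} {τ σ} →
  st′ ⊆ st → τ ⊆ σ → size st′ τ ≤ size st σ
size-mono p q = +-mono-≤ (length-mono-≤ p) (length-mono-≤ q)

private
  cancel-2 : ∀ m n m′ n′ {k} → suc m + suc n ≤ suc m′ + suc n′ + k → m + n ≤ m′ + n′ + k
  cancel-2 m n m′ n′ {k} le = s≤s⁻¹ (s≤s⁻¹
    (subst₂ _≤_ (cong suc (+-suc m n)) (cong (λ l → suc l + k) (+-suc m′ n′)) le))

  budget-pred : ∀ {m n k} → suc m ≤ n + k → n ≤ m → ∃ λ k′ → k ≡ suc k′ × m ≤ n + k′
  budget-pred {n = n} {k = zero} le n≤m =
    ⊥-elim (<-irrefl refl (≤-trans le (≤-trans (≤-reflexive (+-identityʳ n)) n≤m)))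
  budget-pred {n = n} {k = suc k} le _ = k , refl , s≤s⁻¹ (≤-trans le (≤-reflexive (+-suc n k)))

  budget-suc : ∀ {m n k} → m ≤ n + k → m ≤ n + suc k
  budget-suc {n = n} le = ≤-trans le (+-monoʳ-≤ n (n≤1+n _))

  shift-suc : ∀ m n k → m + suc n + k ≡ m + n + suc k
  shift-suc m n k = trans (cong (_+ k) (+-suc m n)) (sym (+-suc (m + n) k))

completable-push : ∀ {s k a} {st : List (Fin s)} {σ} →
  Completable k st (op a ∷ σ) → Completable k (a ∷ st) σ
completable-push {k = k} {st = st} {σ} (completion {st′} {τ} p (_ ∷ʳ q) b le) =
  completion (_ ∷ʳ p) q b (subst (_≤ size st′ τ + k) (+-suc (length st) (length σ)) le)
completable-push {k = k} {st = st} {σ} (completion {st′} {_ ∷ τ} p (refl ∷ q) (push _ b) le) =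
  completion (refl ∷ p) q b
    (subst₂ _≤_ (+-suc (length st) (length σ)) (cong (_+ k) (+-suc (length st′) (length τ))) le)

completable-unmatched : ∀ {s k a} {σ : List (Sym s)} →
  Completable k [] (cl a ∷ σ) → ∃ λ k′ → k ≡ suc k′ × Completable k′ [] σ
completable-unmatched (completion [] (_ ∷ʳ q) b le) with budget-pred le (length-mono-≤ q)
... | k′ , refl , le′ = k′ , refl , completion [] q b le′
completable-unmatched (completion [] (refl ∷ _) () _)

-- Matching greedily is safe: if a completion keeps only one of the top a and
-- the current ā, its partner there can be exchanged for the other at no cost.
completable-match : ∀ {s k a} {st : List (Fin s)} {σ} →
  Completable k (a ∷ st) (cl a ∷ σ) → Completable k st σ
completable-match {st = st} {σ} (completion {_ ∷ st′} {_ ∷ τ} (refl ∷ p) (refl ∷ q) (pop _ b) le) =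
  completion p q b (cancel-2 (length st) (length σ) (length st′) (length τ) le)
completable-match {k = k} {a} {st} {σ} (completion {_ ∷ st′} {τ} (refl ∷ p) (_ ∷ʳ q) b le)
  with balanced-drop b
... | τ′ , τ′⊆τ , len , b′ =
  completion p (⊆-trans τ′⊆τ q) b′
    (cancel-2 (length st) (length σ) (length st′) (length τ′)
      (subst (λ l → size (a ∷ st) (cl a ∷ σ) ≤ suc (length st′) + l + k) len le))
completable-match {st = st} {σ} (completion {_ ∷ st′} {_ ∷ τ} (_ ∷ʳ p) (refl ∷ q) (pop _ b) le) =
  completion (∷ˡ⁻ p) q b (cancel-2 (length st) (length σ) (length st′) (length τ) le)
completable-match (completion {[]} (_ ∷ʳ _) (refl ∷ _) () _)
completable-match {st = st} {σ} (completion (_ ∷ʳ p) (_ ∷ʳ q) b le) =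
  completion p q b (≤-trans (+-mono-≤ (n≤1+n (length st)) (n≤1+n (length σ))) le)

completable-mismatch : ∀ {s k a x} {st : List (Fin s)} {σ} → ¬ x ≡ a →
  Completable k (x ∷ st) (cl a ∷ σ) →
  ∃ λ k′ → k ≡ suc k′ × (Completable k′ st (cl a ∷ σ) ⊎ Completable k′ (x ∷ st) σ)
completable-mismatch x≢a (completion (refl ∷ _) (refl ∷ _) (pop _ _) _) = ⊥-elim (x≢a refl)
completable-mismatch x≢a (completion (_ ∷ʳ p) q b le) with budget-pred le (size-mono p q)
... | k′ , refl , le′ = k′ , refl , inj₁ (completion p q b le′)
completable-mismatch {k = k} {a} {x} {st} {σ} x≢a (completion {st′} {τ} (refl ∷ p) (_ ∷ʳ q) b le)
  with budget-pred (subst (λ l → suc l ≤ size st′ τ + k) (+-suc (length st) (length σ)) le)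
                   (s≤s (size-mono p q))
... | k′ , refl , le′ = k′ , refl , inj₂ (completion (refl ∷ p) q b le′)

completable-delete-top : ∀ {s k x} {st : List (Fin s)} {σ} →
  Completable k (x ∷ st) σ → Completable (suc k) st σ
completable-delete-top {st = st} {σ} (completion (_ ∷ʳ p) q b le) =
  completion p q b (budget-suc (≤-trans (n≤1+n (size st σ)) le))
completable-delete-top {k = k} (completion {_ ∷ st′} (refl ∷ p) q b le) with balanced-drop b
... | τ′ , τ′⊆τ , len , b′ =
  completion p (⊆-trans τ′⊆τ q) b′
    (≤-trans (s≤s⁻¹ le)
      (≤-reflexive (trans (cong (λ l → length st′ + l + k) len)
                          (shift-suc (length st′) (length τ′) k))))

completable-delete-close : ∀ {s k a} {st : List (Fin s)} {σ} →
  Completable k st (cl a ∷ σ) → Completable (suc k) st σ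
completable-delete-close {st = st} {σ} (completion p (_ ∷ʳ q) b le) =
  completion p q b (budget-suc (≤-trans (n≤1+n (size st σ))
    (≤-trans (≤-reflexive (sym (+-suc (length st) (length σ)))) le)))
completable-delete-close {k = k} {st = st} {σ} (completion {_ ∷ st′} {_ ∷ τ} p (refl ∷ q) (pop _ b) le) =
  completion (∷ˡ⁻ p) q b
    (≤-trans (s≤s⁻¹ (≤-trans (≤-reflexive (sym (+-suc (length st) (length σ)))) le))
      (≤-reflexive (shift-suc (length st′) (length τ) k)))

completable-end : ∀ {s k} {st : List (Fin s)} → Completable k st [] → length st ≤ k
completable-end {k = k} {st} (completion p [] [] le) = subst (_≤ k) (+-identityʳ (length st)) le

minDel⇒completable : ∀ {s d} {σ : List (Sym s)} → MinDel σ d → Completable d [] σ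
minDel⇒completable ((τ , τ⊆σ , dyck , len) , _) =
  completion [] τ⊆σ (subst (Balanced []) (++-identityʳ τ) (dyck-++-balanced dyck []))
    (≤-reflexive (sym len))

deletionsFrom : List (Sym s) → List (Fin s) → List Bool → ℕ
deletionsFrom σ st cs = proj₁ (rdel σ st cs)

closeDeletions : Fin s → List (Sym s) → List (Fin s) → List Bool → ℕ
closeDeletions a σ st cs = proj₁ (closeStep a σ st cs)

stepsFrom : List (Sym s) → List (Fin s) → List Bool → ℕ
stepsFrom σ st cs = proj₂ (rdel σ st cs)

closeSteps : Fin s → List (Sym s) → List (Fin s) → List Bool → ℕ
closeSteps a σ st cs = proj₂ (closeStep a σ st cs)

closeDeletions-match : ∀ (a : Fin s) σ st cs →
  closeDeletions a σ (a ∷ st) cs ≡ deletionsFrom σ st cs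
closeDeletions-match a σ st cs with a ≟ᶠ a
... | yes _  = refl
... | no a≢a = ⊥-elim (a≢a refl)

closeDeletions-top : ∀ {a x : Fin s} σ st cs → ¬ x ≡ a →
  closeDeletions a σ (x ∷ st) (true ∷ cs) ≡ suc (closeDeletions a σ st cs)
closeDeletions-top {a = a} {x} σ st cs x≢a with x ≟ᶠ a
... | yes x≡a = ⊥-elim (x≢a x≡a)
... | no _    = refl

closeDeletions-current : ∀ {a x : Fin s} σ st cs → ¬ x ≡ a →
  closeDeletions a σ (x ∷ st) (false ∷ cs) ≡ suc (deletionsFrom σ (x ∷ st) cs)
closeDeletions-current {a = a} {x} σ st cs x≢a with x ≟ᶠ a
... | yes x≡a = ⊥-elim (x≢a x≡a)
... | no _    = refl

mutual
  deletionsFrom-≤ : ∀ (σ : List (Sym s)) st cs → deletionsFrom σ st cs ≤ length σ + length st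
  deletionsFrom-≤ []         st cs = ≤-refl
  deletionsFrom-≤ (op a ∷ σ) st cs =
    ≤-trans (deletionsFrom-≤ σ (a ∷ st) cs) (≤-reflexive (+-suc (length σ) (length st)))
  deletionsFrom-≤ (cl a ∷ σ) st cs = closeDeletions-≤ a σ st cs

  closeDeletions-≤ : ∀ a (σ : List (Sym s)) st cs →
    closeDeletions a σ st cs ≤ suc (length σ + length st)
  closeDeletions-≤ a σ [] cs = s≤s (deletionsFrom-≤ σ [] cs)
  closeDeletions-≤ a σ (x ∷ st) cs with x ≟ᶠ a
  closeDeletions-≤ a σ (x ∷ st) cs           | yes _ =
    ≤-trans (deletionsFrom-≤ σ st cs) (≤-trans (+-monoʳ-≤ (length σ) (n≤1+n _)) (n≤1+n _))
  closeDeletions-≤ a σ (x ∷ st) (true ∷ cs)  | no _ =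
    s≤s (≤-trans (closeDeletions-≤ a σ st cs) (≤-reflexive (sym (+-suc (length σ) (length st)))))
  closeDeletions-≤ a σ (x ∷ st) (false ∷ cs) | no _ = s≤s (deletionsFrom-≤ σ (x ∷ st) cs)
  closeDeletions-≤ a σ (x ∷ st) []           | no _ = s≤s (deletionsFrom-≤ σ (x ∷ st) [])

private
  2*suc : ∀ m n → 2 * suc m + n ≡ suc (suc (2 * m + n))
  2*suc = solve-∀

  2*suc-≥ : ∀ m n → suc (2 * m + n) ≤ 2 * suc m + n
  2*suc-≥ m n = ≤-trans (n≤1+n _) (≤-reflexive (sym (2*suc m n)))

mutual
  stepsFrom-≤ : ∀ (σ : List (Sym s)) st cs → stepsFrom σ st cs ≤ 2 * length σ + length st
  stepsFrom-≤ []         st cs = ≤-refl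
  stepsFrom-≤ (op a ∷ σ) st cs =
    ≤-trans (s≤s (stepsFrom-≤ σ (a ∷ st) cs))
      (≤-reflexive (trans (cong suc (+-suc (2 * length σ) (length st)))
                          (sym (2*suc (length σ) (length st)))))
  stepsFrom-≤ (cl a ∷ σ) st cs = closeSteps-≤ a σ st cs

  closeSteps-≤ : ∀ a (σ : List (Sym s)) st cs →
    closeSteps a σ st cs ≤ 2 * suc (length σ) + length st
  closeSteps-≤ a σ [] cs = ≤-trans (s≤s (stepsFrom-≤ σ [] cs)) (2*suc-≥ (length σ) 0)
  closeSteps-≤ a σ (x ∷ st) cs with x ≟ᶠ a
  closeSteps-≤ a σ (x ∷ st) cs           | yes _ =
    ≤-trans (s≤s (stepsFrom-≤ σ st cs))
      (≤-trans (2*suc-≥ (length σ) (length st)) (+-monoʳ-≤ (2 * suc (length σ)) (n≤1+n _)))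
  closeSteps-≤ a σ (x ∷ st) (true ∷ cs)  | no _ =
    ≤-trans (s≤s (closeSteps-≤ a σ st cs))
      (≤-reflexive (sym (+-suc (2 * suc (length σ)) (length st))))
  closeSteps-≤ a σ (x ∷ st) (false ∷ cs) | no _ =
    ≤-trans (s≤s (stepsFrom-≤ σ (x ∷ st) cs)) (2*suc-≥ (length σ) (suc (length st)))
  closeSteps-≤ a σ (x ∷ st) []           | no _ =
    ≤-trans (s≤s (stepsFrom-≤ σ (x ∷ st) [])) (2*suc-≥ (length σ) (suc (length st)))

-- Sums over all coin sequences of a given length

𝟙 : ∀ {p} {P : Set p} → Dec P → ℕ
𝟙 (yes _) = 1
𝟙 (no _)  = 0

𝟙-mono : ∀ {p q} {P : Set p} {Q : Set q} (P? : Dec P) (Q? : Dec Q) → (P → Q) → 𝟙 P? ≤ 𝟙 Q?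
𝟙-mono (yes _) (yes _) _   = ≤-refl
𝟙-mono (yes p) (no ¬q) P→Q = ⊥-elim (¬q (P→Q p))
𝟙-mono (no _)  _       _   = z≤n

𝟙-yes : ∀ {p} {P : Set p} (P? : Dec P) → P → 𝟙 P? ≡ 1
𝟙-yes (yes _) _ = refl
𝟙-yes (no ¬p) p = ⊥-elim (¬p p)

sumCoins : ℕ → (List Bool → ℕ) → ℕ
sumCoins zero    f = f []
sumCoins (suc L) f = sumCoins L (λ b → f (true ∷ b)) + sumCoins L (λ b → f (false ∷ b))

sumCoins-mono : ∀ L {f g : List Bool → ℕ} →
  (∀ b → length b ≡ L → f b ≤ g b) → sumCoins L f ≤ sumCoins L g
sumCoins-mono zero    f≤g = f≤g [] refl
sumCoins-mono (suc L) f≤g =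
  +-mono-≤ (sumCoins-mono L (λ b len → f≤g (true ∷ b) (cong suc len)))
           (sumCoins-mono L (λ b len → f≤g (false ∷ b) (cong suc len)))

sumCoins-cong : ∀ L {f g : List Bool → ℕ} →
  (∀ b → f b ≡ g b) → sumCoins L f ≡ sumCoins L g
sumCoins-cong zero    f≡g = f≡g []
sumCoins-cong (suc L) f≡g =
  cong₂ _+_ (sumCoins-cong L (λ b → f≡g (true ∷ b))) (sumCoins-cong L (λ b → f≡g (false ∷ b)))

sumCoins-const : ∀ L c → sumCoins L (λ _ → c) ≡ c * 2 ^ L
sumCoins-const zero    c = sym (*-identityʳ c)
sumCoins-const (suc L) c = begin
  sumCoins L (λ _ → c) + sumCoins L (λ _ → c)
    ≡⟨ cong₂ _+_ (sumCoins-const L c) (sumCoins-const L c) ⟩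
  c * 2 ^ L + c * 2 ^ L
    ≡⟨ sym (*-distribˡ-+ c (2 ^ L) (2 ^ L)) ⟩
  c * (2 ^ L + 2 ^ L)
    ≡⟨ cong (λ n → c * (2 ^ L + n)) (sym (+-identityʳ (2 ^ L))) ⟩
  c * 2 ^ suc L ∎
  where open ≡-Reasoning

sumCoins-+ : ∀ L (f g : List Bool → ℕ) →
  sumCoins L (λ b → f b + g b) ≡ sumCoins L f + sumCoins L g
sumCoins-+ zero    f g = refl
sumCoins-+ (suc L) f g = begin
  sumCoins L (λ b → fᵗ b + gᵗ b) + sumCoins L (λ b → fᶠ b + gᶠ b)
    ≡⟨ cong₂ _+_ (sumCoins-+ L fᵗ gᵗ) (sumCoins-+ L fᶠ gᶠ) ⟩
  (sumCoins L fᵗ + sumCoins L gᵗ) + (sumCoins L fᶠ + sumCoins L gᶠ)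
    ≡⟨ +-interchange (sumCoins L fᵗ) (sumCoins L gᵗ) (sumCoins L fᶠ) (sumCoins L gᶠ) ⟩
  (sumCoins L fᵗ + sumCoins L fᶠ) + (sumCoins L gᵗ + sumCoins L gᶠ) ∎
  where
  open ≡-Reasoning
  fᵗ fᶠ gᵗ gᶠ : List Bool → ℕ
  fᵗ b = f (true ∷ b)
  fᶠ b = f (false ∷ b)
  gᵗ b = g (true ∷ b)
  gᶠ b = g (false ∷ b)

sumCoins-* : ∀ L c (f : List Bool → ℕ) → sumCoins L (λ b → c * f b) ≡ c * sumCoins L f
sumCoins-* zero    c f = refl
sumCoins-* (suc L) c f =
  trans (cong₂ _+_ (sumCoins-* L c (λ b → f (true ∷ b))) (sumCoins-* L c (λ b → f (false ∷ b))))
        (sym (*-distribˡ-+ c _ _))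

sumCoins-take : ∀ N r (f : List Bool → ℕ) →
  sumCoins (N + r) (λ b → f (take N b)) ≡ sumCoins N f * 2 ^ r
sumCoins-take zero    r f = sumCoins-const r (f [])
sumCoins-take (suc N) r f =
  trans (cong₂ _+_ (sumCoins-take N r fᵗ) (sumCoins-take N r fᶠ))
        (sym (*-distribʳ-+ (2 ^ r) (sumCoins N fᵗ) (sumCoins N fᶠ)))
  where
  fᵗ fᶠ : List Bool → ℕ
  fᵗ b = f (true ∷ b)
  fᶠ b = f (false ∷ b)

length-filter-map : ∀ {A B : Set} {p} {P : Pred A p} (P? : Decidable P) (f : B → A) xs →
  length (filter P? (map f xs)) ≡ length (filter (P? ∘ f) xs)
length-filter-map P? f []       = refl
length-filter-map P? f (x ∷ xs) with P? (f x)
... | yes _ = cong suc (length-filter-map P? f xs)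
... | no _  = length-filter-map P? f xs

length-filter-allCoins : ∀ {p} {P : Pred (List Bool) p} (P? : Decidable P) L →
  length (filter P? (allCoins L)) ≡ sumCoins L (𝟙 ∘ P?)
length-filter-allCoins P? zero with P? []
... | yes _ = refl
... | no _  = refl
length-filter-allCoins P? (suc L) = begin
  length (filter P? (map (true ∷_) A ++ map (false ∷_) A))
    ≡⟨ cong length (filter-++ P? (map (true ∷_) A) (map (false ∷_) A)) ⟩
  length (filter P? (map (true ∷_) A) ++ filter P? (map (false ∷_) A))
    ≡⟨ length-++ (filter P? (map (true ∷_) A)) ⟩
  length (filter P? (map (true ∷_) A)) + length (filter P? (map (false ∷_) A))
    ≡⟨ cong₂ _+_ (length-filter-map P? (true ∷_) A) (length-filter-map P? (false ∷_) A) ⟩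
  length (filter (P? ∘ (true ∷_)) A) + length (filter (P? ∘ (false ∷_)) A)
    ≡⟨ cong₂ _+_ (length-filter-allCoins (P? ∘ (true ∷_)) L)
                 (length-filter-allCoins (P? ∘ (false ∷_)) L) ⟩
  sumCoins (suc L) (𝟙 ∘ P?) ∎
  where
  open ≡-Reasoning
  A = allCoins L

heads tails : List Bool → ℕ
heads []          = 0
heads (true ∷ b)  = suc (heads b)
heads (false ∷ b) = heads b
tails []          = 0
tails (true ∷ b)  = tails b
tails (false ∷ b) = suc (tails b)

heads+tails : ∀ b → heads b + tails b ≡ length b
heads+tails []          = refl
heads+tails (true ∷ b)  = cong suc (heads+tails b)
heads+tails (false ∷ b) = trans (+-suc (heads b) (tails b)) (cong suc (heads+tails b))

sumCoins-swap : ∀ L (f : ℕ → ℕ → ℕ) →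
  sumCoins L (λ b → f (heads b) (tails b)) ≡ sumCoins L (λ b → f (tails b) (heads b))
sumCoins-swap zero    f = refl
sumCoins-swap (suc L) f =
  trans (cong₂ _+_ (sumCoins-swap L (λ h t → f (suc h) t)) (sumCoins-swap L (λ h t → f h (suc t))))
        (+-comm (sumCoins L (λ b → f (suc (tails b)) (heads b)))
                (sumCoins L (λ b → f (tails b) (suc (heads b)))))

-- Coupling the run with a random walk

-- hitsZero k u bs is 1 if the walk from height k steered by bs (true: down,
-- false: up) reaches 0 before its (u + 1)-st up-step and before bs runs out,
-- and 0 otherwise.
hitsZero : ℕ → ℕ → List Bool → ℕ
hitsZero zero    u       bs           = 1
hitsZero (suc k) u       []           = 0
hitsZero (suc k) u       (true ∷ bs)  = hitsZero k u bs
hitsZero (suc k) zero    (false ∷ bs) = 0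
hitsZero (suc k) (suc u) (false ∷ bs) = hitsZero (suc (suc k)) u bs

hitsZero-≤1 : ∀ k u bs → hitsZero k u bs ≤ 1
hitsZero-≤1 zero    u       bs           = ≤-refl
hitsZero-≤1 (suc k) u       []           = z≤n
hitsZero-≤1 (suc k) u       (true ∷ bs)  = hitsZero-≤1 k u bs
hitsZero-≤1 (suc k) zero    (false ∷ bs) = z≤n
hitsZero-≤1 (suc k) (suc u) (false ∷ bs) = hitsZero-≤1 (suc (suc k)) u bs

hitsZero-suc : ∀ k u bs → hitsZero (suc k) u bs ≤ hitsZero k u bs
hitsZero-suc zero    u       bs           = hitsZero-≤1 1 u bs
hitsZero-suc (suc k) u       []           = z≤n
hitsZero-suc (suc k) u       (true ∷ bs)  = hitsZero-suc k u bs
hitsZero-suc (suc k) zero    (false ∷ bs) = z≤n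
hitsZero-suc (suc k) (suc u) (false ∷ bs) = hitsZero-suc (suc (suc k)) u bs

hitsZero-++ : ∀ k u ps bs → tails ps + k ≤ heads ps → tails ps ≤ u →
  hitsZero k u (ps ++ bs) ≡ 1
hitsZero-++ zero    u       ps           bs _     _ = refl
hitsZero-++ (suc k) u       []           bs ()    _
hitsZero-++ (suc k) u       (true ∷ ps)  bs ahead tails≤u =
  hitsZero-++ k u ps bs (s≤s⁻¹ (≤-trans (≤-reflexive (sym (+-suc (tails ps) k))) ahead)) tails≤u
hitsZero-++ (suc k) zero    (false ∷ ps) bs _     ()
hitsZero-++ (suc k) (suc u) (false ∷ ps) bs ahead tails≤u =
  hitsZero-++ (suc (suc k)) u ps bs
    (≤-trans (≤-reflexive (+-suc (tails ps) (suc k))) ahead) (s≤s⁻¹ tails≤u)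

private
  +-mono-≤-crossed : ∀ {m n p q} → m ≤ q → n ≤ p → m + n ≤ p + q
  +-mono-≤-crossed {p = p} {q} m≤q n≤p =
    ≤-trans (+-mono-≤ m≤q n≤p) (≤-reflexive (+-comm q p))

  up-step : ∀ k u → suc (suc (suc k) + 2 * u) ≤ suc k + 2 * suc u
  up-step k u = ≤-reflexive (eq k u)
    where
    eq : ∀ k u → suc (suc (suc k) + 2 * u) ≡ suc k + 2 * suc u
    eq = solve-∀

-- At a mismatch the good coin value is coupled with a down-step of the walk and
-- the bad one with an up-step; when the good value is false this swaps the two
-- halves of the coin space.
mutual
  coupling : ∀ (σ : List (Sym s)) st {k} u L → Completable k st σ →
    sumCoins L (hitsZero k u) ≤
    sumCoins L (λ cs → 𝟙 (deletionsFrom σ st cs ≤? k + 2 * u))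
  coupling [] st {k} u L w = sumCoins-mono L λ cs _ →
    ≤-trans (hitsZero-≤1 k u cs)
      (≤-reflexive (sym (𝟙-yes (length st ≤? k + 2 * u)
        (≤-trans (completable-end w) (m≤m+n k (2 * u))))))
  coupling (op a ∷ σ) st u L w = coupling σ (a ∷ st) u L (completable-push w)
  coupling (cl a ∷ σ) st u L w = coupling-close a σ st u L w

  coupling-close : ∀ a (σ : List (Sym s)) st {k} u L → Completable k st (cl a ∷ σ) →
    sumCoins L (hitsZero k u) ≤
    sumCoins L (λ cs → 𝟙 (closeDeletions a σ st cs ≤? k + 2 * u))
  coupling-close a σ [] u L w with completable-unmatched w
  ... | k′ , refl , w′ =
    ≤-trans (sumCoins-mono L (λ bs _ → hitsZero-suc k′ u bs))
      (≤-trans (coupling σ [] u L w′)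
        (sumCoins-mono L (λ cs _ → 𝟙-mono (_ ≤? _) (_ ≤? _) s≤s)))
  coupling-close a σ (x ∷ st) u L w = coupling-split (x ≟ᶠ a) σ st u L w

  coupling-split : ∀ {a x : Fin s} → Dec (x ≡ a) → ∀ σ st {k} u L →
    Completable k (x ∷ st) (cl a ∷ σ) →
    sumCoins L (hitsZero k u) ≤
    sumCoins L (λ cs → 𝟙 (closeDeletions a σ (x ∷ st) cs ≤? k + 2 * u))
  coupling-split {a = a} (yes refl) σ st u L w =
    ≤-trans (coupling σ st u L (completable-match w))
      (sumCoins-mono L (λ cs _ → 𝟙-mono (_ ≤? _) (_ ≤? _)
        (≤-trans (≤-reflexive (closeDeletions-match a σ st cs)))))
  coupling-split (no x≢a) σ st u L w with completable-mismatch x≢a w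
  ... | k′ , refl , side = coupling-mismatch x≢a σ st u L w side

  coupling-mismatch : ∀ {a x : Fin s} → ¬ x ≡ a → ∀ σ st {k} u L →
    Completable (suc k) (x ∷ st) (cl a ∷ σ) →
    Completable k st (cl a ∷ σ) ⊎ Completable k (x ∷ st) σ →
    sumCoins L (hitsZero (suc k) u) ≤
    sumCoins L (λ cs → 𝟙 (closeDeletions a σ (x ∷ st) cs ≤? suc k + 2 * u))
  coupling-mismatch x≢a σ st u zero _ _ = z≤n
  coupling-mismatch x≢a σ st zero (suc L) _ (inj₁ top) =
    +-mono-≤ (coupling-top x≢a σ st 0 L ≤-refl top)
             (≤-trans (≤-reflexive (sumCoins-const L 0)) z≤n)
  coupling-mismatch x≢a σ st zero (suc L) _ (inj₂ cur) =
    +-mono-≤-crossed (coupling-current x≢a σ st 0 L ≤-refl cur)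
                     (≤-trans (≤-reflexive (sumCoins-const L 0)) z≤n)
  coupling-mismatch x≢a σ st {k} (suc u) (suc L) w (inj₁ top) =
    +-mono-≤ (coupling-top x≢a σ st (suc u) L ≤-refl top)
             (coupling-current x≢a σ st u L (up-step k u) (completable-delete-close w))
  coupling-mismatch x≢a σ st {k} (suc u) (suc L) w (inj₂ cur) =
    +-mono-≤-crossed (coupling-current x≢a σ st (suc u) L ≤-refl cur)
                     (coupling-top x≢a σ st u L (up-step k u) (completable-delete-top w))

  coupling-top : ∀ {a x : Fin s} → ¬ x ≡ a → ∀ σ st {k} u L {b} → suc (k + 2 * u) ≤ b →
    Completable k st (cl a ∷ σ) →
    sumCoins L (hitsZero k u) ≤
    sumCoins L (λ cs → 𝟙 (closeDeletions a σ (x ∷ st) (true ∷ cs) ≤? b))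
  coupling-top {a = a} {x} x≢a σ st u L {b} bound w =
    ≤-trans (coupling-close a σ st u L w)
      (sumCoins-mono L (λ cs _ → 𝟙-mono (_ ≤? _) (_ ≤? _) λ le →
        ≤-trans (≤-reflexive (closeDeletions-top σ st cs x≢a)) (≤-trans (s≤s le) bound)))

  coupling-current : ∀ {a x : Fin s} → ¬ x ≡ a → ∀ σ st {k} u L {b} → suc (k + 2 * u) ≤ b →
    Completable k (x ∷ st) σ →
    sumCoins L (hitsZero k u) ≤
    sumCoins L (λ cs → 𝟙 (closeDeletions a σ (x ∷ st) (false ∷ cs) ≤? b))
  coupling-current {a = a} {x} x≢a σ st u L {b} bound w =
    ≤-trans (coupling σ (x ∷ st) u L w)
      (sumCoins-mono L (λ cs _ → 𝟙-mono (_ ≤? _) (_ ≤? _) λ le →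
        ≤-trans (≤-reflexive (closeDeletions-current σ st cs x≢a)) (≤-trans (s≤s le) bound)))

-- Moments of the walk

displacement : List Bool → ℕ
displacement b = ∣ heads b - tails b ∣

-- One more coin moves the displacement X to X ± 1, or from 0 to 1 twice.
∣-∣-step : ∀ (f g : ℕ → ℕ) →
  f 1 + f 1 ≡ g 0 → (∀ z → f (2 + z) + f z ≡ g (1 + z)) →
  ∀ h t → f ∣ suc h - t ∣ + f ∣ h - suc t ∣ ≡ g ∣ h - t ∣
∣-∣-step f g base step zero    zero    = base
∣-∣-step f g base step zero    (suc t) = trans (+-comm (f t) _) (step t)
∣-∣-step f g base step (suc h) zero    rewrite ∣-∣-identityʳ h = step h
∣-∣-step f g base step (suc h) (suc t) = ∣-∣-step f g base step h t

sumCoins-displacement-step : ∀ (f g : ℕ → ℕ) →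
  f 1 + f 1 ≡ g 0 → (∀ z → f (2 + z) + f z ≡ g (1 + z)) → ∀ L →
  sumCoins (suc L) (f ∘ displacement) ≡ sumCoins L (g ∘ displacement)
sumCoins-displacement-step f g base step L =
  trans (sym (sumCoins-+ L (f ∘ displacement ∘ (true ∷_)) (f ∘ displacement ∘ (false ∷_))))
        (sumCoins-cong L (λ b → ∣-∣-step f g base step (heads b) (tails b)))

sumCoins-displacement² : ∀ L → let X = displacement in sumCoins L (λ b → X b * X b) ≡ L * 2 ^ L
sumCoins-displacement² zero    = refl
sumCoins-displacement² (suc L) = begin
  sumCoins (suc L) (λ b → X b * X b)
    ≡⟨ sumCoins-displacement-step (λ x → x * x) (λ x → 2 * (x * x) + 2) refl step L ⟩
  sumCoins L (λ b → 2 * (X b * X b) + 2)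
    ≡⟨ sumCoins-+ L _ _ ⟩
  sumCoins L (λ b → 2 * (X b * X b)) + sumCoins L (λ _ → 2)
    ≡⟨ cong₂ _+_ (trans (sumCoins-* L 2 _) (cong (2 *_) (sumCoins-displacement² L)))
                 (sumCoins-const L 2) ⟩
  2 * (L * 2 ^ L) + 2 * 2 ^ L
    ≡⟨ close L (2 ^ L) ⟩
  suc L * 2 ^ suc L ∎
  where
  open ≡-Reasoning
  X = displacement
  step : ∀ z → (2 + z) * (2 + z) + z * z ≡ 2 * ((1 + z) * (1 + z)) + 2
  step = solve-∀
  close : ∀ L p → 2 * (L * p) + 2 * p ≡ (1 + L) * (2 * p)
  close = solve-∀

sumCoins-displacement⁴ : ∀ L → let X = displacement in
  sumCoins L (λ b → X b * X b * (X b * X b)) + 2 * L * 2 ^ L ≡ 3 * L * L * 2 ^ L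
sumCoins-displacement⁴ zero    = refl
sumCoins-displacement⁴ (suc L) = begin
  S₄ (suc L) + 2 * suc L * 2 ^ suc L
    ≡⟨ cong (_+ 2 * suc L * 2 ^ suc L) expand ⟩
  2 * S₄ L + 12 * (L * 2 ^ L) + 2 * 2 ^ L + 2 * suc L * 2 ^ suc L
    ≡⟨ regroup (S₄ L) L (2 ^ L) ⟩
  2 * (S₄ L + 2 * L * 2 ^ L) + 12 * (L * 2 ^ L) + 6 * 2 ^ L
    ≡⟨ cong (λ n → 2 * n + 12 * (L * 2 ^ L) + 6 * 2 ^ L) (sumCoins-displacement⁴ L) ⟩
  2 * (3 * L * L * 2 ^ L) + 12 * (L * 2 ^ L) + 6 * 2 ^ L
    ≡⟨ close L (2 ^ L) ⟩
  3 * suc L * suc L * 2 ^ suc L ∎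
  where
  open ≡-Reasoning
  X = displacement
  S₄ : ℕ → ℕ
  S₄ L = sumCoins L (λ b → X b * X b * (X b * X b))
  step : ∀ z → (2 + z) * (2 + z) * ((2 + z) * (2 + z)) + z * z * (z * z)
             ≡ 2 * ((1 + z) * (1 + z) * ((1 + z) * (1 + z))) + 12 * ((1 + z) * (1 + z)) + 2
  step = solve-∀
  regroup : ∀ m L p → 2 * m + 12 * (L * p) + 2 * p + 2 * (1 + L) * (2 * p)
                    ≡ 2 * (m + 2 * L * p) + 12 * (L * p) + 6 * p
  regroup = solve-∀
  close : ∀ L p → 2 * (3 * L * L * p) + 12 * (L * p) + 6 * p ≡ 3 * (1 + L) * (1 + L) * (2 * p)
  close = solve-∀
  expand : S₄ (suc L) ≡ 2 * S₄ L + 12 * (L * 2 ^ L) + 2 * 2 ^ L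
  expand = begin
    S₄ (suc L)
      ≡⟨ sumCoins-displacement-step (λ x → x * x * (x * x))
           (λ x → 2 * (x * x * (x * x)) + 12 * (x * x) + 2) refl step L ⟩
    sumCoins L (λ b → 2 * (X b * X b * (X b * X b)) + 12 * (X b * X b) + 2)
      ≡⟨ sumCoins-+ L _ _ ⟩
    sumCoins L (λ b → 2 * (X b * X b * (X b * X b)) + 12 * (X b * X b)) + sumCoins L (λ _ → 2)
      ≡⟨ cong₂ _+_ (sumCoins-+ L _ _) (sumCoins-const L 2) ⟩
    sumCoins L (λ b → 2 * (X b * X b * (X b * X b)))
      + sumCoins L (λ b → 12 * (X b * X b)) + 2 * 2 ^ L
      ≡⟨ cong₂ (λ m n → m + n + 2 * 2 ^ L) (sumCoins-* L 2 _)
               (trans (sumCoins-* L 12 _) (cong (12 *_) (sumCoins-displacement² L))) ⟩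
    2 * S₄ L + 12 * (L * 2 ^ L) + 2 * 2 ^ L ∎

∣-∣≤ : ∀ h t d → h ≤ t + d → t ≤ h + d → ∣ h - t ∣ ≤ d
∣-∣≤ zero    t       d _  t≤d = t≤d
∣-∣≤ (suc h) zero    d h≤d _  = h≤d
∣-∣≤ (suc h) (suc t) d h≤  t≤ = ∣-∣≤ h t d (s≤s⁻¹ h≤) (s≤s⁻¹ t≤)

2mn≤m²+n² : ∀ m n → 2 * m * n ≤ m * m + n * n
2mn≤m²+n² m n with ≤-total m n
... | inj₁ m≤n with m≤n⇒∃[o]m+o≡n m≤n
...   | o , refl = ≤-trans (m≤m+n _ (o * o)) (≤-reflexive (eq m o))
  where
  eq : ∀ m o → 2 * m * (m + o) + o * o ≡ m * m + (m + o) * (m + o)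
  eq = solve-∀
2mn≤m²+n² m n | inj₂ n≤m with m≤n⇒∃[o]m+o≡n n≤m
...   | o , refl = ≤-trans (m≤m+n _ (o * o)) (≤-reflexive (eq n o))
  where
  eq : ∀ n o → 2 * (n + o) * n + o * o ≡ (n + o) * (n + o) + n * n
  eq = solve-∀

-- Either |h − t| ≥ d, and then the indicator pays for AM-GM's T², or |h − t| < d.
fourth-moment-pointwise : ∀ d T h t → let X = ∣ h - t ∣ in
  2 * T * (X * X) ≤
  X * X * (X * X) + T * T * (𝟙 (t + d ≤? h) + 𝟙 (h + d ≤? t)) + 2 * T * (d * d)
fourth-moment-pointwise d T h t with t + d ≤? h | h + d ≤? t
... | yes _ | _ =
  ≤-trans (≤-trans (2mn≤m²+n² T (X * X)) (≤-reflexive (+-comm (T * T) _)))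
    (≤-trans (+-monoʳ-≤ (X * X * (X * X)) (m≤m*n (T * T) (suc _))) (m≤m+n _ _))
  where X = ∣ h - t ∣
... | no _  | yes _ =
  ≤-trans (≤-trans (2mn≤m²+n² T (X * X)) (≤-reflexive (+-comm (T * T) _)))
    (≤-trans (+-monoʳ-≤ (X * X * (X * X)) (≤-reflexive (sym (*-identityʳ (T * T)))))
             (m≤m+n _ _))
  where X = ∣ h - t ∣
... | no h<t+d | no t<h+d = ≤-trans (*-monoʳ-≤ (2 * T) (*-mono-≤ X≤d X≤d)) (m≤n+m _ _)
  where
  X≤d : ∣ h - t ∣ ≤ d
  X≤d = ∣-∣≤ h t d (<⇒≤ (≰⇒> h<t+d)) (<⇒≤ (≰⇒> t<h+d))

ahead : ℕ → List Bool → ℕ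
ahead d b = 𝟙 (tails b + d ≤? heads b)

fourth-moment-sum : ∀ d T N → let X = displacement ; A = sumCoins N (ahead d) in
  2 * T * (N * 2 ^ N) ≤
  sumCoins N (λ b → X b * X b * (X b * X b)) + T * T * (A + A) + 2 * T * (d * d) * 2 ^ N
fourth-moment-sum d T N = begin
  2 * T * (N * 2 ^ N)
    ≡⟨ cong (2 * T *_) (sym (sumCoins-displacement² N)) ⟩
  2 * T * sumCoins N (λ b → X b * X b)
    ≡⟨ sym (sumCoins-* N (2 * T) _) ⟩
  sumCoins N (λ b → 2 * T * (X b * X b))
    ≤⟨ sumCoins-mono N (λ b _ → fourth-moment-pointwise d T (heads b) (tails b)) ⟩
  sumCoins N (λ b → X⁴ b + T * T * (ahead d b + behind b) + 2 * T * (d * d))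
    ≡⟨ sumCoins-+ N _ _ ⟩
  sumCoins N (λ b → X⁴ b + T * T * (ahead d b + behind b))
    + sumCoins N (λ _ → 2 * T * (d * d))
    ≡⟨ cong₂ _+_ (sumCoins-+ N _ _) (sumCoins-const N (2 * T * (d * d))) ⟩
  sumCoins N X⁴ + sumCoins N (λ b → T * T * (ahead d b + behind b)) + 2 * T * (d * d) * 2 ^ N
    ≡⟨ cong (λ n → sumCoins N X⁴ + n + 2 * T * (d * d) * 2 ^ N) indicators ⟩
  sumCoins N X⁴ + T * T * (A + A) + 2 * T * (d * d) * 2 ^ N ∎
  where
  open ≤-Reasoning
  X = displacement
  X⁴ : List Bool → ℕ
  X⁴ b = X b * X b * (X b * X b)
  behind : List Bool → ℕ
  behind b = 𝟙 (heads b + d ≤? tails b)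
  A = sumCoins N (ahead d)
  indicators : sumCoins N (λ b → T * T * (ahead d b + behind b)) ≡ T * T * (A + A)
  indicators = trans (sumCoins-* N (T * T) _) (cong (T * T *_)
    (trans (sumCoins-+ N (ahead d) behind)
           (cong (A +_) (sym (sumCoins-swap N (λ h t → 𝟙 (t + d ≤? h)))))))

-- With T = 9N the fourth moment uses up 3N²P and the d² term at most 12N²P of
-- the 18N²P on the left, leaving 3N²P ≤ 162N²A.
moment-arithmetic : ∀ N P A M D → .{{_ : NonZero N}} → M + 2 * N * P ≡ 3 * N * N * P →
  2 * (9 * N) * (N * P) ≤ M + 9 * N * (9 * N) * (A + A) + 2 * (9 * N) * D * P →
  3 * D ≤ 2 * N → P ≤ 54 * A
moment-arithmetic N P A M D moment4 sum 3D≤2N =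
  *-cancelˡ-≤ (3 * N * N) {{m*n≢0 (3 * N) N {{m*n≢0 3 N}}}}
    (≤-trans (+-cancelˡ-≤ (15 * N * N * P) _ _ bound) (≤-reflexive (eq₄ N A)))
  where
  open ≤-Reasoning
  bound : 15 * N * N * P + 3 * N * N * P ≤ 15 * N * N * P + 162 * N * N * A
  bound = begin
    15 * N * N * P + 3 * N * N * P                                      ≡⟨ eq₁ N P ⟩
    2 * (9 * N) * (N * P)                                               ≤⟨ m≤m+n _ (2 * N * P) ⟩
    2 * (9 * N) * (N * P) + 2 * N * P                                   ≤⟨ +-monoˡ-≤ (2 * N * P) sum ⟩
    M + 9 * N * (9 * N) * (A + A) + 2 * (9 * N) * D * P + 2 * N * P     ≡⟨ eq₂ M N A D P ⟩
    (M + 2 * N * P) + 162 * N * N * A + 6 * N * P * (3 * D)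
      ≡⟨ cong (λ n → n + 162 * N * N * A + 6 * N * P * (3 * D)) moment4 ⟩
    3 * N * N * P + 162 * N * N * A + 6 * N * P * (3 * D)
      ≤⟨ +-monoʳ-≤ (3 * N * N * P + 162 * N * N * A) (*-monoʳ-≤ (6 * N * P) 3D≤2N) ⟩
    3 * N * N * P + 162 * N * N * A + 6 * N * P * (2 * N)               ≡⟨ eq₃ N P A ⟩
    15 * N * N * P + 162 * N * N * A                                    ∎
    where
    eq₁ : ∀ N P → 15 * N * N * P + 3 * N * N * P ≡ 2 * (9 * N) * (N * P)
    eq₁ = solve-∀
    eq₂ : ∀ M N A D P → M + 9 * N * (9 * N) * (A + A) + 2 * (9 * N) * D * P + 2 * N * P
                        ≡ (M + 2 * N * P) + 162 * N * N * A + 6 * N * P * (3 * D)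
    eq₂ = solve-∀
    eq₃ : ∀ N P A → 3 * N * N * P + 162 * N * N * A + 6 * N * P * (2 * N)
                    ≡ 15 * N * N * P + 162 * N * N * A
    eq₃ = solve-∀
  eq₄ : ∀ N A → 162 * N * N * A ≡ 3 * N * N * (54 * A)
  eq₄ = solve-∀

walkLength : ℕ → ℕ
walkLength d = d + 2 * (d * pred d)

ahead-estimate : ∀ d → 2 ^ walkLength d ≤ 54 * sumCoins (walkLength d) (ahead d)
ahead-estimate zero          = s≤s z≤n
ahead-estimate (suc zero)    = s≤s (s≤s z≤n)
ahead-estimate d@(suc (suc e)) =
  moment-arithmetic N (2 ^ N) (sumCoins N (ahead d)) (sumCoins N (λ b → X b * X b * (X b * X b)))
    (d * d) (sumCoins-displacement⁴ N) (fourth-moment-sum d (9 * N) N)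
    (≤-trans (m≤m+n _ _) (≤-reflexive (eq e)))
  where
  N = walkLength d
  X = displacement
  eq : ∀ e → 3 * ((2 + e) * (2 + e)) + (2 + e) * e ≡ 2 * ((2 + e) + 2 * ((2 + e) * (1 + e)))
  eq = solve-∀

walkLength-≤ : ∀ d → walkLength d ≤ 2 * d * d
walkLength-≤ zero    = z≤n
walkLength-≤ (suc e) = ≤-trans (m≤m+n _ (suc e)) (≤-reflexive (eq e))
  where
  eq : ∀ e → (1 + e) + 2 * ((1 + e) * e) + (1 + e) ≡ 2 * (1 + e) * (1 + e)
  eq = solve-∀

tails-≤ : ∀ d u ps → length ps ≡ d + 2 * u → tails ps + d ≤ heads ps → tails ps ≤ u
tails-≤ d u ps len ahead = *-cancelˡ-≤ 2 (+-cancelˡ-≤ d _ _ (begin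
  d + 2 * tails ps           ≡⟨ eq d (tails ps) ⟩
  tails ps + d + tails ps    ≤⟨ +-monoˡ-≤ (tails ps) ahead ⟩
  heads ps + tails ps        ≡⟨ trans (heads+tails ps) len ⟩
  d + 2 * u                  ∎))
  where
  open ≤-Reasoning
  eq : ∀ d t → d + 2 * t ≡ t + d + t
  eq = solve-∀

ahead-take≤hitsZero : ∀ d b → walkLength d ≤ length b →
  ahead d (take (walkLength d) b) ≤ hitsZero d (d * pred d) b
ahead-take≤hitsZero d b N≤len
  with tails (take (walkLength d) b) + d ≤? heads (take (walkLength d) b)
... | no _ = z≤n
... | yes is-ahead = ≤-reflexive (sym (subst (λ bs → hitsZero d u bs ≡ 1) (take++drop≡id N b)
        (hitsZero-++ d u (take N b) (drop N b) is-ahead (tails-≤ d u (take N b) len is-ahead))))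
  where
  N = walkLength d
  u = d * pred d
  len : length (take N b) ≡ N
  len = trans (length-take N b) (m≤n⇒m⊓n≡m N≤len)

goodCount-sumCoins : ∀ (σ : List (Sym s)) b →
  goodCount σ b ≡ sumCoins (length σ) (λ cs → 𝟙 (deletions σ cs ≤? b))
goodCount-sumCoins σ b = length-filter-allCoins (λ cs → deletions σ cs ≤? b) (length σ)

goodCount-short : ∀ (σ : List (Sym s)) d → length σ < walkLength d →
  goodCount σ (2 * d * d) ≡ 2 ^ length σ
goodCount-short σ d n<N = begin
  goodCount σ (2 * d * d)                              ≡⟨ goodCount-sumCoins σ (2 * d * d) ⟩
  sumCoins n (λ cs → 𝟙 (deletions σ cs ≤? 2 * d * d))  ≡⟨ sumCoins-cong n (𝟙-yes _ ∘ few) ⟩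
  sumCoins n (λ _ → 1)                                 ≡⟨ sumCoins-const n 1 ⟩
  2 ^ n + 0                                            ≡⟨ +-identityʳ (2 ^ n) ⟩
  2 ^ n                                                ∎
  where
  open ≡-Reasoning
  n = length σ
  few : ∀ cs → deletions σ cs ≤ 2 * d * d
  few cs = ≤-trans (deletionsFrom-≤ σ [] cs)
    (≤-trans (≤-reflexive (+-identityʳ n)) (≤-trans (<⇒≤ n<N) (walkLength-≤ d)))

goodCount-long : ∀ (σ : List (Sym s)) d → MinDel σ d → walkLength d ≤ length σ →
  2 ^ length σ ≤ 54 * goodCount σ (2 * d * d)
goodCount-long σ d opt N≤n = begin
  2 ^ n                                    ≡⟨ cong (2 ^_) (sym N+r≡n) ⟩
  2 ^ (N + r)                              ≡⟨ ^-distribˡ-+-* 2 N r ⟩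
  2 ^ N * 2 ^ r                            ≤⟨ *-monoˡ-≤ (2 ^ r) (ahead-estimate d) ⟩
  54 * A * 2 ^ r                           ≡⟨ *-assoc 54 A (2 ^ r) ⟩
  54 * (A * 2 ^ r)                         ≡⟨ cong (54 *_) (sym (sumCoins-take N r (ahead d))) ⟩
  54 * sumCoins (N + r) (ahead d ∘ take N) ≡⟨ cong (λ L → 54 * sumCoins L _) N+r≡n ⟩
  54 * sumCoins n (ahead d ∘ take N)
    ≤⟨ *-monoʳ-≤ 54 (sumCoins-mono n (λ b len →
         ahead-take≤hitsZero d b (subst (N ≤_) (sym len) N≤n))) ⟩
  54 * sumCoins n (hitsZero d u)
    ≤⟨ *-monoʳ-≤ 54 (coupling σ [] u n (minDel⇒completable opt)) ⟩
  54 * sumCoins n (λ cs → 𝟙 (deletionsFrom σ [] cs ≤? N))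
    ≤⟨ *-monoʳ-≤ 54 (sumCoins-mono n (λ cs _ →
         𝟙-mono (_ ≤? _) (_ ≤? _) (λ le → ≤-trans le (walkLength-≤ d)))) ⟩
  54 * sumCoins n (λ cs → 𝟙 (deletions σ cs ≤? 2 * d * d))
    ≡⟨ cong (54 *_) (sym (goodCount-sumCoins σ (2 * d * d))) ⟩
  54 * goodCount σ (2 * d * d) ∎
  where
  open ≤-Reasoning
  n = length σ
  N = walkLength d
  u = d * pred d
  A = sumCoins N (ahead d)
  r = n ∸ N
  N+r≡n : N + r ≡ n
  N+r≡n = m+[n∸m]≡n N≤n

random-deletion-succeeds : ∀ (σ : List (Sym s)) d → MinDel σ d →
  2 ^ length σ ≤ 54 * goodCount σ (2 * d * d)
random-deletion-succeeds σ d opt with walkLength d ≤? length σ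
... | yes N≤n = goodCount-long σ d opt N≤n
... | no  N≰n = ≤-trans (m≤n*m (2 ^ length σ) 54)
                  (*-monoʳ-≤ 54 (≤-reflexive (sym (goodCount-short σ d (≰⇒> N≰n)))))

theorem5 : ∃ λ (c : ℕ) → ∃ λ (k : ℕ) →
    ∀ (s : ℕ) → 2 ≤ s → ∀ (σ : List (Sym s)) (d : ℕ) → MinDel σ d →
      (∀ (cs : List Bool) → steps σ cs ≤ c * length σ + c)
      × (2 ^ length σ ≤ k * goodCount σ (2 * d * d))
theorem5 = 2 , 54 , λ s _ σ d opt →
  (λ cs → ≤-trans (stepsFrom-≤ σ [] cs) (+-monoʳ-≤ (2 * length σ) z≤n)) ,
  random-deletion-succeeds σ d opt
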